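{- For every closed computation $M$ of $\lambda_c^u$: $M$ converges (i.e. $M\Downarrow V$ for some closed value $V$) if and only if there is a computation type $\tau$ with $\tau\neq_{\mathsf C}\omega_{\mathsf C}$ such that $\vdash M:\tau$ is derivable with the empty basis.
   Context: Syntax of $\lambda_c^u$: values $V ::= x\mid \lambda x.M$, computations $M ::= \mathit{unit}\,V\mid M\star V$; $M[V/x]$ is capture-avoiding substitution. Convergence $\Downarrow$ is the least relation between closed computations and closed values such that $\mathit{unit}\,V\Downarrow V$, and if $M\Downarrow V$ and $N[V/x]\Downarrow W$ then $M\star\lambda x.N\Downarrow W$. Types: value types $\delta ::= \alpha\mid \delta\to\tau\mid \delta\wedge\delta\mid \omega_{\mathsf V}$ ($\alpha$ ranging over a countable set of type variables) and computation types $\tau ::= T\delta\mid \tau\wedge\tau\mid \omega_{\mathsf C}$. The preorders $\le_{\mathsf V}$ on value types and $\le_{\mathsf C}$ on computation types are the least preorders such that, for each sort, $\omega$ is the top, $\wedge$ is monotone, idempotent and commutative, $\sigma\wedge\sigma'\le\sigma$, and $\sigma\le\sigma',\sigma\le\sigma''$ imply $\sigma\le\sigma'\wedge\sigma''$; moreover $\omega_{\mathsf V}\le_{\mathsf V}\omega_{\mathsf V}\to\omega_{\mathsf C}$, $(\delta\to\tau)\wedge(\delta\to\tau')\le_{\mathsf V}\delta\to(\tau\wedge\tau')$, $\delta'\le_{\mathsf V}\delta$ and $\tau\le_{\mathsf C}\tau'$ imply $\delta\to\tau\le_{\mathsf V}\delta'\to\tau'$, $T\delta\wedge T\delta'\le_{\mathsf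 C}T(\delta\wedge\delta')$, and $\delta\le_{\mathsf V}\delta'$ implies $T\delta\le_{\mathsf C}T\delta'$. $\tau =_{\mathsf C}\tau'$ means $\tau\le_{\mathsf C}\tau'$ and $\tau'\le_{\mathsf C}\tau$. A basis $\Gamma$ is a finite set $\{x_1:\delta_1,\dots,x_n:\delta_n\}$ with distinct variables; $\Gamma,x:\delta$ denotes extension with $x$ not already in $\Gamma$. Typing rules: (Ax) $x:\delta\in\Gamma \Rightarrow \Gamma\vdash x:\delta$; ($\to$I) $\Gamma,x:\delta\vdash M:\tau\Rightarrow\Gamma\vdash\lambda x.M:\delta\to\tau$; (unit I) $\Gamma\vdash V:\delta\Rightarrow\Gamma\vdash\mathit{unit}\,V:T\delta$; ($\to$E) $\Gamma\vdash M:T\delta$ and $\Gamma\vdash V:\delta\to\tau$ $\Rightarrow \Gamma\vdash M\star V:\tau$; and, for both values (with $\omega_{\mathsf V},\le_{\mathsf V}$) and computations (with $\omega_{\mathsf C},\le_{\mathsf C}$): ($\omega$) $\Gamma\vdash P:\omega$; ($\wedge$I) $\Gamma\vdash P:\sigma$ and $\Gamma\vdash P:\sigma'$ give $\Gamma\vdash P:\sigma\wedge\sigma'$; ($\le$) $\Gamma\vdash P:\sigma$ and $\sigma\le\sigma'$ give $\Gamma\vdash P:\sigma'$. -}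

module Defs where

open import Data.Nat using (ℕ; zero; suc)
open import Data.Fin using (Fin; zero; suc)
open import Data.Product using (_×_)

-- Syntax of λ_c^u, well-scoped de Bruijn representation.
-- Val n / Comp n : values / computations with free variables among Fin n.
-- Closed terms are those of scope 0.

mutual
  data Val (n : ℕ) : Set where
    var : Fin n → Val n
    lam : Comp (suc n) → Val n          -- λx.M  (x is de Bruijn index 0)

  data Comp (n : ℕ) : Set where
    unit : Val n → Comp n
    _⋆_  : Comp n → Val n → Comp n

infixl 5 _⋆_

Ren : ℕ → ℕ → Set
Ren m n = Fin m → Fin n

liftR : ∀ {m n} → Ren m n → Ren (suc m) (suc n)
liftR ρ zero    = zero
liftR ρ (suc i) = suc (ρ i)

mutual
  renV : ∀ {m n} → Ren m n → Val m → Val n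
  renV ρ (var i) = var (ρ i)
  renV ρ (lam M) = lam (renC (liftR ρ) M)

  renC : ∀ {m n} → Ren m n → Comp m → Comp n
  renC ρ (unit V) = unit (renV ρ V)
  renC ρ (M ⋆ V)  = renC ρ M ⋆ renV ρ V

Sub : ℕ → ℕ → Set
Sub m n = Fin m → Val n

liftS : ∀ {m n} → Sub m n → Sub (suc m) (suc n)
liftS σ zero    = var zero
liftS σ (suc i) = renV suc (σ i)

mutual
  subV : ∀ {m n} → Sub m n → Val m → Val n
  subV σ (var i) = σ i
  subV σ (lam M) = lam (subC (liftS σ) M)

  subC : ∀ {m n} → Sub m n → Comp m → Comp n
  subC σ (unit V) = unit (subV σ V)
  subC σ (M ⋆ V)  = subC σ M ⋆ subV σ V

single : ∀ {n} → Val n → Sub (suc n) n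
single V zero    = V
single V (suc i) = var i

_[_] : ∀ {n} → Comp (suc n) → Val n → Comp n
N [ V ] = subC (single V) N

data _⇓_ : Comp 0 → Val 0 → Set where
  ⇓unit : ∀ {V} → unit V ⇓ V
  ⇓bind : ∀ {M N V W} → M ⇓ V → (N [ V ]) ⇓ W → (M ⋆ lam N) ⇓ W

infix 4 _⇓_

mutual
  data VType : Set where
    tvar : ℕ → VType
    _⇒_  : VType → CType → VType
    _∧v_ : VType → VType → VType
    ωV   : VType

  data CType : Set where
    T    : VType → CType
    _∧c_ : CType → CType → CType
    ωC   : CType

infixr 6 _⇒_
infixr 7 _∧v_ _∧c_

mutual
  data _≤V_ : VType → VType → Set where
    reflV   : ∀ {δ} → δ ≤V δ
    transV  : ∀ {δ δ' δ''} → δ ≤V δ' → δ' ≤V δ'' → δ ≤V δ''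
    topV    : ∀ {δ} → δ ≤V ωV
    monoV   : ∀ {δ₁ δ₂ δ₁' δ₂'} → δ₁ ≤V δ₁' → δ₂ ≤V δ₂' → (δ₁ ∧v δ₂) ≤V (δ₁' ∧v δ₂')
    idemV₁  : ∀ {δ} → (δ ∧v δ) ≤V δ
    idemV₂  : ∀ {δ} → δ ≤V (δ ∧v δ)
    commV   : ∀ {δ δ'} → (δ ∧v δ') ≤V (δ' ∧v δ)
    projV   : ∀ {δ δ'} → (δ ∧v δ') ≤V δ
    glbV    : ∀ {δ δ' δ''} → δ ≤V δ' → δ ≤V δ'' → δ ≤V (δ' ∧v δ'')
    ω⇒      : ωV ≤V (ωV ⇒ ωC)
    ⇒∧      : ∀ {δ τ τ'} → ((δ ⇒ τ) ∧v (δ ⇒ τ')) ≤V (δ ⇒ (τ ∧c τ'))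
    ⇒mono   : ∀ {δ δ' τ τ'} → δ' ≤V δ → τ ≤C τ' → (δ ⇒ τ) ≤V (δ' ⇒ τ')

  data _≤C_ : CType → CType → Set where
    reflC   : ∀ {τ} → τ ≤C τ
    transC  : ∀ {τ τ' τ''} → τ ≤C τ' → τ' ≤C τ'' → τ ≤C τ''
    topC    : ∀ {τ} → τ ≤C ωC
    monoC   : ∀ {τ₁ τ₂ τ₁' τ₂'} → τ₁ ≤C τ₁' → τ₂ ≤C τ₂' → (τ₁ ∧c τ₂) ≤C (τ₁' ∧c τ₂')
    idemC₁  : ∀ {τ} → (τ ∧c τ) ≤C τ
    idemC₂  : ∀ {τ} → τ ≤C (τ ∧c τ)
    commC   : ∀ {τ τ'} → (τ ∧c τ') ≤C (τ' ∧c τ)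
    projC   : ∀ {τ τ'} → (τ ∧c τ') ≤C τ
    glbC    : ∀ {τ τ' τ''} → τ ≤C τ' → τ ≤C τ'' → τ ≤C (τ' ∧c τ'')
    T∧      : ∀ {δ δ'} → (T δ ∧c T δ') ≤C T (δ ∧v δ')
    Tmono   : ∀ {δ δ'} → δ ≤V δ' → T δ ≤C T δ'

infix 4 _≤V_ _≤C_ _=C_

_=C_ : CType → CType → Set
τ =C τ' = (τ ≤C τ') × (τ' ≤C τ)

Basis : ℕ → Set
Basis n = Fin n → VType

extend : ∀ {n} → Basis n → VType → Basis (suc n)
extend Γ δ zero    = δ
extend Γ δ (suc i) = Γ i

emptyBasis : Basis 0
emptyBasis ()

mutual
  data _⊢v_∶_ {n : ℕ} (Γ : Basis n) : Val n → VType → Set where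
    ax    : ∀ {i} → Γ ⊢v var i ∶ Γ i
    ⇒I    : ∀ {M δ τ} → extend Γ δ ⊢c M ∶ τ → Γ ⊢v lam M ∶ (δ ⇒ τ)
    ωIv   : ∀ {V} → Γ ⊢v V ∶ ωV
    ∧Iv   : ∀ {V δ δ'} → Γ ⊢v V ∶ δ → Γ ⊢v V ∶ δ' → Γ ⊢v V ∶ (δ ∧v δ')
    ≤v    : ∀ {V δ δ'} → Γ ⊢v V ∶ δ → δ ≤V δ' → Γ ⊢v V ∶ δ'

  data _⊢c_∶_ {n : ℕ} (Γ : Basis n) : Comp n → CType → Set where
    unitI : ∀ {V δ} → Γ ⊢v V ∶ δ → Γ ⊢c unit V ∶ T δ
    ⇒E    : ∀ {M V δ τ} → Γ ⊢c M ∶ T δ → Γ ⊢v V ∶ (δ ⇒ τ) → Γ ⊢c (M ⋆ V) ∶ τ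
    ωIc   : ∀ {M} → Γ ⊢c M ∶ ωC
    ∧Ic   : ∀ {M τ τ'} → Γ ⊢c M ∶ τ → Γ ⊢c M ∶ τ' → Γ ⊢c M ∶ (τ ∧c τ')
    ≤c    : ∀ {M τ τ'} → Γ ⊢c M ∶ τ → τ ≤C τ' → Γ ⊢c M ∶ τ'

infix 3 _⊢v_∶_ _⊢c_∶_

-- Completeness is subject expansion: intersection types make substitution
-- reversible, so a type of N[V/x] splits into a type δ of V and a typing of N
-- under x : δ; following the big-step derivation backwards, any type of the
-- final value W yields T δ for M.  Soundness is a logical-relations argument:
-- T δ is read as "converges to a value realising δ", the interpretation is
-- closed under ≤ and under the typing rules, and every type not equal to ω
-- contains a conjunct T δ, whose realisers converge.
module Submission where

open import Defs
open import Data.Empty using (⊥; ⊥-elim)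
open import Data.Fin using (Fin; zero; suc)
open import Data.Nat using (suc)
open import Data.Product using (Σ; _×_; _,_; proj₁; proj₂; map₂)
open import Data.Sum using (_⊎_; inj₁; inj₂)
open import Data.Unit using (⊤; tt)
open import Relation.Nullary using (¬_)
open import Relation.Binary.PropositionalEquality
  using (_≡_; _≗_; refl; sym; trans; cong; cong₂; subst)

-- Substitution

liftR-cong : ∀ {m n} {ρ ρ' : Ren m n} → ρ ≗ ρ' → liftR ρ ≗ liftR ρ'
liftR-cong eq zero    = refl
liftR-cong eq (suc i) = cong suc (eq i)

liftS-cong : ∀ {m n} {σ σ' : Sub m n} → σ ≗ σ' → liftS σ ≗ liftS σ'
liftS-cong eq zero    = refl
liftS-cong eq (suc i) = cong (renV suc) (eq i)

mutual
  renV-cong : ∀ {m n} {ρ ρ' : Ren m n} → ρ ≗ ρ' → renV ρ ≗ renV ρ'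
  renV-cong eq (var i) = cong var (eq i)
  renV-cong eq (lam M) = cong lam (renC-cong (liftR-cong eq) M)

  renC-cong : ∀ {m n} {ρ ρ' : Ren m n} → ρ ≗ ρ' → renC ρ ≗ renC ρ'
  renC-cong eq (unit V) = cong unit (renV-cong eq V)
  renC-cong eq (M ⋆ V)  = cong₂ _⋆_ (renC-cong eq M) (renV-cong eq V)

mutual
  subV-cong : ∀ {m n} {σ σ' : Sub m n} → σ ≗ σ' → subV σ ≗ subV σ'
  subV-cong eq (var i) = eq i
  subV-cong eq (lam M) = cong lam (subC-cong (liftS-cong eq) M)

  subC-cong : ∀ {m n} {σ σ' : Sub m n} → σ ≗ σ' → subC σ ≗ subC σ'
  subC-cong eq (unit V) = cong unit (subV-cong eq V)
  subC-cong eq (M ⋆ V)  = cong₂ _⋆_ (subC-cong eq M) (subV-cong eq V)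

mutual
  renV-renV : ∀ {k m n} (ρ : Ren m n) (ρ' : Ren k m) V →
              renV ρ (renV ρ' V) ≡ renV (λ i → ρ (ρ' i)) V
  renV-renV ρ ρ' (var i) = refl
  renV-renV ρ ρ' (lam M) = cong lam (trans (renC-renC (liftR ρ) (liftR ρ') M)
    (renC-cong (λ { zero → refl ; (suc i) → refl }) M))

  renC-renC : ∀ {k m n} (ρ : Ren m n) (ρ' : Ren k m) M →
              renC ρ (renC ρ' M) ≡ renC (λ i → ρ (ρ' i)) M
  renC-renC ρ ρ' (unit V) = cong unit (renV-renV ρ ρ' V)
  renC-renC ρ ρ' (M ⋆ V)  = cong₂ _⋆_ (renC-renC ρ ρ' M) (renV-renV ρ ρ' V)

mutual
  subV-renV : ∀ {k m n} (σ : Sub m n) (ρ : Ren k m) V →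
              subV σ (renV ρ V) ≡ subV (λ i → σ (ρ i)) V
  subV-renV σ ρ (var i) = refl
  subV-renV σ ρ (lam M) = cong lam (trans (subC-renC (liftS σ) (liftR ρ) M)
    (subC-cong (λ { zero → refl ; (suc i) → refl }) M))

  subC-renC : ∀ {k m n} (σ : Sub m n) (ρ : Ren k m) M →
              subC σ (renC ρ M) ≡ subC (λ i → σ (ρ i)) M
  subC-renC σ ρ (unit V) = cong unit (subV-renV σ ρ V)
  subC-renC σ ρ (M ⋆ V)  = cong₂ _⋆_ (subC-renC σ ρ M) (subV-renV σ ρ V)

mutual
  renV-subV : ∀ {k m n} (ρ : Ren m n) (σ : Sub k m) V →
              renV ρ (subV σ V) ≡ subV (λ i → renV ρ (σ i)) V
  renV-subV ρ σ (var i) = refl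
  renV-subV ρ σ (lam M) = cong lam (trans (renC-subC (liftR ρ) (liftS σ) M)
    (subC-cong (λ { zero → refl
                  ; (suc i) → trans (renV-renV (liftR ρ) suc (σ i))
                                    (sym (renV-renV suc ρ (σ i))) }) M))

  renC-subC : ∀ {k m n} (ρ : Ren m n) (σ : Sub k m) M →
              renC ρ (subC σ M) ≡ subC (λ i → renV ρ (σ i)) M
  renC-subC ρ σ (unit V) = cong unit (renV-subV ρ σ V)
  renC-subC ρ σ (M ⋆ V)  = cong₂ _⋆_ (renC-subC ρ σ M) (renV-subV ρ σ V)

mutual
  subV-subV : ∀ {k m n} (σ : Sub m n) (σ' : Sub k m) V →
              subV σ (subV σ' V) ≡ subV (λ i → subV σ (σ' i)) V
  subV-subV σ σ' (var i) = refl
  subV-subV σ σ' (lam M) = cong lam (trans (subC-subC (liftS σ) (liftS σ') M)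
    (subC-cong (λ { zero → refl
                  ; (suc i) → trans (subV-renV (liftS σ) suc (σ' i))
                                    (sym (renV-subV suc σ (σ' i))) }) M))

  subC-subC : ∀ {k m n} (σ : Sub m n) (σ' : Sub k m) M →
              subC σ (subC σ' M) ≡ subC (λ i → subV σ (σ' i)) M
  subC-subC σ σ' (unit V) = cong unit (subV-subV σ σ' V)
  subC-subC σ σ' (M ⋆ V)  = cong₂ _⋆_ (subC-subC σ σ' M) (subV-subV σ σ' V)

mutual
  subV-id : ∀ {n} {σ : Sub n n} → σ ≗ var → subV σ ≗ (λ V → V)
  subV-id eq (var i) = eq i
  subV-id eq (lam M) = cong lam (subC-id (liftS-id eq) M)
    where
    liftS-id : ∀ {n} {σ : Sub n n} → σ ≗ var → liftS σ ≗ var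
    liftS-id eq zero    = refl
    liftS-id eq (suc i) = cong (renV suc) (eq i)

  subC-id : ∀ {n} {σ : Sub n n} → σ ≗ var → subC σ ≗ (λ M → M)
  subC-id eq (unit V) = cong unit (subV-id eq V)
  subC-id eq (M ⋆ V)  = cong₂ _⋆_ (subC-id eq M) (subV-id eq V)

extendSub : ∀ {m n} → Sub m n → Val n → Sub (suc m) n
extendSub σ W zero    = W
extendSub σ W (suc i) = σ i

subC-liftS-[] : ∀ {m n} (σ : Sub m n) W M →
                subC (liftS σ) M [ W ] ≡ subC (extendSub σ W) M
subC-liftS-[] σ W M = trans (subC-subC (single W) (liftS σ) M) (subC-cong pointwise M)
  where
  pointwise : (λ i → subV (single W) (liftS σ i)) ≗ extendSub σ W
  pointwise zero    = refl
  pointwise (suc i) = trans (subV-renV (single W) suc (σ i)) (subV-id (λ _ → refl) (σ i))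

-- Subject expansion

_≤Γ_ : ∀ {n} → Basis n → Basis n → Set
Δ' ≤Γ Δ = ∀ i → Δ' i ≤V Δ i

infix 4 _≤Γ_

_∧Γ_ : ∀ {n} → Basis n → Basis n → Basis n
(Δ₁ ∧Γ Δ₂) i = Δ₁ i ∧v Δ₂ i

∧Γ-≤ˡ : ∀ {n} (Δ₁ Δ₂ : Basis n) → Δ₁ ∧Γ Δ₂ ≤Γ Δ₁
∧Γ-≤ˡ Δ₁ Δ₂ i = projV

∧Γ-≤ʳ : ∀ {n} (Δ₁ Δ₂ : Basis n) → Δ₁ ∧Γ Δ₂ ≤Γ Δ₂
∧Γ-≤ʳ Δ₁ Δ₂ i = transV commV projV

extend-≤Γ : ∀ {n} {Δ' Δ : Basis n} {δ' δ} → Δ' ≤Γ Δ → δ' ≤V δ → extend Δ' δ' ≤Γ extend Δ δ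
extend-≤Γ le le₀ zero    = le₀
extend-≤Γ le le₀ (suc i) = le i

mutual
  ⊢v-weaken : ∀ {n} {Δ' Δ : Basis n} {V δ} → Δ' ≤Γ Δ → Δ ⊢v V ∶ δ → Δ' ⊢v V ∶ δ
  ⊢v-weaken le (ax {i})  = ≤v ax (le i)
  ⊢v-weaken le (⇒I d)    = ⇒I (⊢c-weaken (extend-≤Γ le reflV) d)
  ⊢v-weaken le ωIv       = ωIv
  ⊢v-weaken le (∧Iv d e) = ∧Iv (⊢v-weaken le d) (⊢v-weaken le e)
  ⊢v-weaken le (≤v d q)  = ≤v (⊢v-weaken le d) q

  ⊢c-weaken : ∀ {n} {Δ' Δ : Basis n} {M τ} → Δ' ≤Γ Δ → Δ ⊢c M ∶ τ → Δ' ⊢c M ∶ τ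
  ⊢c-weaken le (unitI d) = unitI (⊢v-weaken le d)
  ⊢c-weaken le (⇒E d e)  = ⇒E (⊢c-weaken le d) (⊢v-weaken le e)
  ⊢c-weaken le ωIc       = ωIc
  ⊢c-weaken le (∧Ic d e) = ∧Ic (⊢c-weaken le d) (⊢c-weaken le e)
  ⊢c-weaken le (≤c d q)  = ≤c (⊢c-weaken le d) q

var-generation : ∀ {n} {Γ : Basis n} {i δ} → Γ ⊢v var i ∶ δ → Γ i ≤V δ
var-generation ax        = reflV
var-generation ωIv       = topV
var-generation (∧Iv d e) = glbV (var-generation d) (var-generation e)
var-generation (≤v d q)  = transV (var-generation d) q

_⊢s_∶_ : ∀ {m n} → Basis n → Sub m n → Basis m → Set
Γ ⊢s σ ∶ Δ = ∀ i → Γ ⊢v σ i ∶ Δ i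

infix 3 _⊢s_∶_

mutual
  ⊢v-unrename : ∀ {m n} {Γ : Basis n} (ρ : Ren m n) V {δ} →
                Γ ⊢v renV ρ V ∶ δ → (λ i → Γ (ρ i)) ⊢v V ∶ δ
  ⊢v-unrename ρ (var i) d = ≤v ax (var-generation d)
  ⊢v-unrename {Γ = Γ} ρ (lam M) (⇒I {δ = δ} d) =
    ⇒I (⊢c-weaken extend-liftR (⊢c-unrename (liftR ρ) M d))
    where
    extend-liftR : extend (λ i → Γ (ρ i)) δ ≤Γ (λ i → extend Γ δ (liftR ρ i))
    extend-liftR zero    = reflV
    extend-liftR (suc i) = reflV
  ⊢v-unrename ρ (lam M) ωIv       = ωIv
  ⊢v-unrename ρ (lam M) (∧Iv d e) = ∧Iv (⊢v-unrename ρ (lam M) d) (⊢v-unrename ρ (lam M) e)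
  ⊢v-unrename ρ (lam M) (≤v d q)  = ≤v (⊢v-unrename ρ (lam M) d) q

  ⊢c-unrename : ∀ {m n} {Γ : Basis n} (ρ : Ren m n) M {τ} →
                Γ ⊢c renC ρ M ∶ τ → (λ i → Γ (ρ i)) ⊢c M ∶ τ
  ⊢c-unrename ρ (unit V) (unitI d) = unitI (⊢v-unrename ρ V d)
  ⊢c-unrename ρ (M ⋆ V)  (⇒E d e)  = ⇒E (⊢c-unrename ρ M d) (⊢v-unrename ρ V e)
  ⊢c-unrename ρ M ωIc              = ωIc
  ⊢c-unrename ρ M (∧Ic d e)        = ∧Ic (⊢c-unrename ρ M d) (⊢c-unrename ρ M e)
  ⊢c-unrename ρ M (≤c d q)         = ≤c (⊢c-unrename ρ M d) q

pointBasis : ∀ {m} → Fin m → VType → Basis m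
pointBasis zero    δ zero    = δ
pointBasis zero    δ (suc j) = ωV
pointBasis (suc i) δ zero    = ωV
pointBasis (suc i) δ (suc j) = pointBasis i δ j

pointBasis-at : ∀ {m} (i : Fin m) δ → pointBasis i δ i ≤V δ
pointBasis-at zero    δ = reflV
pointBasis-at (suc i) δ = pointBasis-at i δ

⊢s-pointBasis : ∀ {m n} {Γ : Basis n} (σ : Sub m n) i {δ} →
                Γ ⊢v σ i ∶ δ → Γ ⊢s σ ∶ pointBasis i δ
⊢s-pointBasis σ zero    d zero    = d
⊢s-pointBasis σ zero    d (suc j) = ωIv
⊢s-pointBasis σ (suc i) d zero    = ωIv
⊢s-pointBasis σ (suc i) d (suc j) = ⊢s-pointBasis (λ k → σ (suc k)) i d j

Expansion : ∀ {m n} → Basis n → Sub m n → (Basis m → Set) → Set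
Expansion {m} Γ σ P = Σ (Basis m) λ Δ → (Γ ⊢s σ ∶ Δ) × P Δ

Antitone : ∀ {m} → (Basis m → Set) → Set
Antitone P = ∀ {Δ' Δ} → Δ' ≤Γ Δ → P Δ → P Δ'

expansion-× : ∀ {m n} {Γ : Basis n} {σ : Sub m n} {P Q : Basis m → Set} →
              Antitone P → Antitone Q →
              Expansion Γ σ P → Expansion Γ σ Q → Expansion Γ σ (λ Δ → P Δ × Q Δ)
expansion-× antiP antiQ (Δ₁ , σ₁ , p) (Δ₂ , σ₂ , q) =
  Δ₁ ∧Γ Δ₂ , (λ i → ∧Iv (σ₁ i) (σ₂ i)) ,
  antiP (∧Γ-≤ˡ Δ₁ Δ₂) p , antiQ (∧Γ-≤ʳ Δ₁ Δ₂) q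

mutual
  ⊢v-unsubst : ∀ {m n} {Γ : Basis n} (σ : Sub m n) V {δ} →
               Γ ⊢v subV σ V ∶ δ → Expansion Γ σ (λ Δ → Δ ⊢v V ∶ δ)
  ⊢v-unsubst σ (var i) {δ} d = pointBasis i δ , ⊢s-pointBasis σ i d , ≤v ax (pointBasis-at i δ)
  ⊢v-unsubst σ (lam N) (⇒I {δ = δ} d) with ⊢c-unsubst (liftS σ) N d
  ... | Δ , ⊢σ , ⊢N = (λ i → Δ (suc i)) , (λ i → ⊢v-unrename suc (σ i) (⊢σ (suc i))) ,
                      ⇒I (⊢c-weaken extend-tail ⊢N)
    where
    extend-tail : extend (λ i → Δ (suc i)) δ ≤Γ Δ
    extend-tail zero    = var-generation (⊢σ zero)
    extend-tail (suc i) = reflV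
  ⊢v-unsubst σ (lam N) ωIv       = (λ _ → ωV) , (λ _ → ωIv) , ωIv
  ⊢v-unsubst σ (lam N) (∧Iv d e) =
    map₂ (map₂ λ { (p , q) → ∧Iv p q })
      (expansion-× ⊢v-weaken ⊢v-weaken (⊢v-unsubst σ (lam N) d) (⊢v-unsubst σ (lam N) e))
  ⊢v-unsubst σ (lam N) (≤v d q)  = map₂ (map₂ λ p → ≤v p q) (⊢v-unsubst σ (lam N) d)

  ⊢c-unsubst : ∀ {m n} {Γ : Basis n} (σ : Sub m n) M {τ} →
               Γ ⊢c subC σ M ∶ τ → Expansion Γ σ (λ Δ → Δ ⊢c M ∶ τ)
  ⊢c-unsubst σ (unit V) (unitI d) = map₂ (map₂ unitI) (⊢v-unsubst σ V d)
  ⊢c-unsubst σ (M ⋆ V)  (⇒E d e)  =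
    map₂ (map₂ λ { (p , q) → ⇒E p q })
      (expansion-× ⊢c-weaken ⊢v-weaken (⊢c-unsubst σ M d) (⊢v-unsubst σ V e))
  ⊢c-unsubst σ M ωIc       = (λ _ → ωV) , (λ _ → ωIv) , ωIc
  ⊢c-unsubst σ M (∧Ic d e) =
    map₂ (map₂ λ { (p , q) → ∧Ic p q })
      (expansion-× ⊢c-weaken ⊢c-weaken (⊢c-unsubst σ M d) (⊢c-unsubst σ M e))
  ⊢c-unsubst σ M (≤c d q)  = map₂ (map₂ λ p → ≤c p q) (⊢c-unsubst σ M d)

⊢c-[]⁻¹ : ∀ (N : Comp 1) {V τ} → emptyBasis ⊢c N [ V ] ∶ τ →
          Σ VType λ δ → (emptyBasis ⊢v V ∶ δ) × (extend emptyBasis δ ⊢c N ∶ τ)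
⊢c-[]⁻¹ N {V} d with ⊢c-unsubst (single V) N d
... | Δ , ⊢V , ⊢N = Δ zero , ⊢V zero , ⊢c-weaken extend-empty ⊢N
  where
  extend-empty : extend emptyBasis (Δ zero) ≤Γ Δ
  extend-empty zero = reflV

⇓-typed : ∀ {M V} → M ⇓ V → ∀ {δ} → emptyBasis ⊢v V ∶ δ → emptyBasis ⊢c M ∶ T δ
⇓-typed ⇓unit            ⊢V = unitI ⊢V
⇓-typed (⇓bind {N = N} M⇓ N⇓) ⊢W with ⊢c-[]⁻¹ N (⇓-typed N⇓ ⊢W)
... | δ , ⊢V , ⊢N = ⇒E (⇓-typed M⇓ ⊢V) (⇒I ⊢N)

Trivial : CType → Set
Trivial (T _)    = ⊥
Trivial (τ ∧c τ') = Trivial τ × Trivial τ'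
Trivial ωC       = ⊤

Trivial-≤C : ∀ {τ τ'} → τ ≤C τ' → Trivial τ → Trivial τ'
Trivial-≤C reflC        t       = t
Trivial-≤C (transC p q) t       = Trivial-≤C q (Trivial-≤C p t)
Trivial-≤C topC         t       = tt
Trivial-≤C (monoC p q)  (a , b) = Trivial-≤C p a , Trivial-≤C q b
Trivial-≤C idemC₁       (a , b) = a
Trivial-≤C idemC₂       t       = t , t
Trivial-≤C commC        (a , b) = b , a
Trivial-≤C projC        (a , b) = a
Trivial-≤C (glbC p q)   t       = Trivial-≤C p t , Trivial-≤C q t
Trivial-≤C T∧           (() , _)
Trivial-≤C (Tmono p)    ()

T-≠ωC : ∀ δ → ¬ (T δ =C ωC)
T-≠ωC δ (_ , ωC≤Tδ) = Trivial-≤C ωC≤Tδ tt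

-- Soundness

Converges : Comp 0 → Set
Converges M = Σ (Val 0) λ V → M ⇓ V

⇓-deterministic : ∀ {M V W} → M ⇓ V → M ⇓ W → V ≡ W
⇓-deterministic ⇓unit ⇓unit = refl
⇓-deterministic (⇓bind p q) (⇓bind p' q') with ⇓-deterministic p p'
... | refl = ⇓-deterministic q q'

unit-⋆-lam-⇓⁻¹ : ∀ {V N W} → unit V ⋆ lam N ⇓ W → N [ V ] ⇓ W
unit-⋆-lam-⇓⁻¹ (⇓bind ⇓unit q) = q

mutual
  𝒱⟦_⟧ : VType → Val 0 → Set
  𝒱⟦ tvar _ ⟧  V = ⊤
  𝒱⟦ δ ⇒ τ ⟧   V = ∀ W → 𝒱⟦ δ ⟧ W → 𝒞⟦ τ ⟧ (unit W ⋆ V)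
  𝒱⟦ δ ∧v δ' ⟧ V = 𝒱⟦ δ ⟧ V × 𝒱⟦ δ' ⟧ V
  𝒱⟦ ωV ⟧      V = ⊤

  𝒞⟦_⟧ : CType → Comp 0 → Set
  𝒞⟦ T δ ⟧     M = Σ (Val 0) λ V → (M ⇓ V) × 𝒱⟦ δ ⟧ V
  𝒞⟦ τ ∧c τ' ⟧ M = 𝒞⟦ τ ⟧ M × 𝒞⟦ τ' ⟧ M
  𝒞⟦ ωC ⟧      M = ⊤

mutual
  𝒱-≤V : ∀ {δ δ'} → δ ≤V δ' → ∀ {V} → 𝒱⟦ δ ⟧ V → 𝒱⟦ δ' ⟧ V
  𝒱-≤V reflV        v       = v
  𝒱-≤V (transV p q) v       = 𝒱-≤V q (𝒱-≤V p v)
  𝒱-≤V topV         v       = tt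
  𝒱-≤V (monoV p q)  (a , b) = 𝒱-≤V p a , 𝒱-≤V q b
  𝒱-≤V idemV₁       (a , b) = a
  𝒱-≤V idemV₂       v       = v , v
  𝒱-≤V commV        (a , b) = b , a
  𝒱-≤V projV        (a , b) = a
  𝒱-≤V (glbV p q)   v       = 𝒱-≤V p v , 𝒱-≤V q v
  𝒱-≤V ω⇒           v       = λ W _ → tt
  𝒱-≤V ⇒∧           (f , g) = λ W w → f W w , g W w
  𝒱-≤V (⇒mono p q)  f       = λ W w → 𝒞-≤C q (f W (𝒱-≤V p w))

  𝒞-≤C : ∀ {τ τ'} → τ ≤C τ' → ∀ {M} → 𝒞⟦ τ ⟧ M → 𝒞⟦ τ' ⟧ M
  𝒞-≤C reflC        c       = c
  𝒞-≤C (transC p q) c       = 𝒞-≤C q (𝒞-≤C p c)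
  𝒞-≤C topC         c       = tt
  𝒞-≤C (monoC p q)  (a , b) = 𝒞-≤C p a , 𝒞-≤C q b
  𝒞-≤C idemC₁       (a , b) = a
  𝒞-≤C idemC₂       c       = c , c
  𝒞-≤C commC        (a , b) = b , a
  𝒞-≤C projC        (a , b) = a
  𝒞-≤C (glbC p q)   c       = 𝒞-≤C p c , 𝒞-≤C q c
  𝒞-≤C T∧ ((V , p , a) , (V' , p' , b)) with ⇓-deterministic p p'
  ... | refl = V , p , a , b
  𝒞-≤C (Tmono p)    (V , q , a) = V , q , 𝒱-≤V p a

𝒞-⇓-closed : ∀ τ {M M'} → (∀ {W} → M ⇓ W → M' ⇓ W) → 𝒞⟦ τ ⟧ M → 𝒞⟦ τ ⟧ M'
𝒞-⇓-closed (T δ)     f (V , p , a) = V , f p , a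
𝒞-⇓-closed (τ ∧c τ') f (a , b)     = 𝒞-⇓-closed τ f a , 𝒞-⇓-closed τ' f b
𝒞-⇓-closed ωC        f c           = tt

𝒞-converges : ∀ τ → (τ =C ωC) ⊎ (∀ {M} → 𝒞⟦ τ ⟧ M → Converges M)
𝒞-converges (T δ) = inj₂ λ { (V , p , _) → V , p }
𝒞-converges ωC    = inj₁ (reflC , reflC)
𝒞-converges (τ ∧c τ') with 𝒞-converges τ | 𝒞-converges τ'
... | inj₁ (_ , ω≤τ) | inj₁ (_ , ω≤τ') = inj₁ (topC , glbC ω≤τ ω≤τ')
... | inj₂ conv      | _               = inj₂ λ c → conv (proj₁ c)
... | inj₁ _         | inj₂ conv'      = inj₂ λ c → conv' (proj₂ c)

_⊨s_ : ∀ {n} → Basis n → Sub n 0 → Set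
Γ ⊨s σ = ∀ i → 𝒱⟦ Γ i ⟧ (σ i)

infix 3 _⊨s_

mutual
  ⊢v-sound : ∀ {n} {Γ : Basis n} {V δ} → Γ ⊢v V ∶ δ → ∀ σ → Γ ⊨s σ → 𝒱⟦ δ ⟧ (subV σ V)
  ⊢v-sound (ax {i})  σ ⊨σ = ⊨σ i
  ⊢v-sound {Γ = Γ} (⇒I {M = M} {δ} {τ} d) σ ⊨σ W w =
    𝒞-⇓-closed τ (λ q → ⇓bind ⇓unit (subst (_⇓ _) (sym (subC-liftS-[] σ W M)) q))
      (⊢c-sound d (extendSub σ W) ⊨σW)
    where
    ⊨σW : extend Γ δ ⊨s extendSub σ W
    ⊨σW zero    = w
    ⊨σW (suc i) = ⊨σ i
  ⊢v-sound ωIv       σ ⊨σ = tt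
  ⊢v-sound (∧Iv d e) σ ⊨σ = ⊢v-sound d σ ⊨σ , ⊢v-sound e σ ⊨σ
  ⊢v-sound (≤v d q)  σ ⊨σ = 𝒱-≤V q (⊢v-sound d σ ⊨σ)

  ⊢c-sound : ∀ {n} {Γ : Basis n} {M τ} → Γ ⊢c M ∶ τ → ∀ σ → Γ ⊨s σ → 𝒞⟦ τ ⟧ (subC σ M)
  ⊢c-sound (unitI {V} d) σ ⊨σ = subV σ V , ⇓unit , ⊢v-sound d σ ⊨σ
  ⊢c-sound (⇒E {M} {V} {δ} {τ} d e) σ ⊨σ = bind (subV σ V) (⊢v-sound e σ ⊨σ) (⊢c-sound d σ ⊨σ)
    where
    bind : ∀ U → 𝒱⟦ δ ⇒ τ ⟧ U → 𝒞⟦ T δ ⟧ (subC σ M) → 𝒞⟦ τ ⟧ (subC σ M ⋆ U)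
    bind (lam N) f (V₀ , M⇓ , v) = 𝒞-⇓-closed τ (λ q → ⇓bind M⇓ (unit-⋆-lam-⇓⁻¹ q)) (f V₀ v)
  ⊢c-sound ωIc       σ ⊨σ = tt
  ⊢c-sound (∧Ic d e) σ ⊨σ = ⊢c-sound d σ ⊨σ , ⊢c-sound e σ ⊨σ
  ⊢c-sound (≤c d q)  σ ⊨σ = 𝒞-≤C q (⊢c-sound d σ ⊨σ)

⊢c-closed-sound : ∀ {M τ} → emptyBasis ⊢c M ∶ τ → 𝒞⟦ τ ⟧ M
⊢c-closed-sound {M} {τ} d = subst 𝒞⟦ τ ⟧ (subC-id (λ ()) M) (⊢c-sound d (λ ()) (λ ()))

mainTheorem2 : (M : Comp 0) →
    ((Σ (Val 0) λ V → M ⇓ V) → (Σ CType λ τ → (¬ (τ =C ωC)) × (emptyBasis ⊢c M ∶ τ)))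
    × ((Σ CType λ τ → (¬ (τ =C ωC)) × (emptyBasis ⊢c M ∶ τ)) → (Σ (Val 0) λ V → M ⇓ V))
mainTheorem2 M = typable , converges
  where
  typable : Converges M → Σ CType λ τ → ¬ (τ =C ωC) × emptyBasis ⊢c M ∶ τ
  typable (V , M⇓V) = T ωV , T-≠ωC ωV , ⇓-typed M⇓V ωIv

  converges : (Σ CType λ τ → ¬ (τ =C ωC) × emptyBasis ⊢c M ∶ τ) → Converges M
  converges (τ , τ≠ω , ⊢M) with 𝒞-converges τ
  ... | inj₁ τ=ω  = ⊥-elim (τ≠ω τ=ω)
  ... | inj₂ conv = conv (⊢c-closed-sound ⊢M)
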